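{- Let $h(x)=\sum_{k\ge1}h_kx^k\in\mathbb{K}[[x]]$ with $h_k\ne0$ for all $k\ge1$, let $y_0\in\mathbb{K}$, and let $G:(\mathbb{K}[[x]],d)\to(\mathbb{K}[[x]],d)$ be a non-expansive function. Then the initial value problem $\mathcal{D}_h(y)=G(y)$, $y(0)=y_0$, has a unique solution $y\in\mathbb{K}[[x]]$. This solution is the unique fixed point of $F:\mathbb{K}[[x]]\to\mathbb{K}[[x]]$ defined by $F(f)=y_0+(\mathcal{I}_h\circ G)(f)$.
   Context: $\mathbb{K}$ is a field of characteristic zero. On $\mathbb{K}[[x]]$, $\omega(s)$ denotes the order of a series (index of its first nonzero coefficient) and $d(f,g)=2^{ -\omega(f-g)}$ (with $d(f,f)=0$). A function $G$ is non-expansive if $d(G(f),G(g))\le d(f,g)$ for all $f,g$. For $h$ as in the statement, the $h$-derivative is $\mathcal{D}_h\big(\sum_{k\ge0}s_kx^k\big)=\sum_{k\ge1}h_ks_kx^{k-1}$ and the $h$-integral is $\mathcal{I}_h\big(\sum_{k\ge0}s_kx^k\big)=\sum_{k\ge0}\frac{s_k}{h_{k+1}}x^{k+1}$. $y(0)$ denotes the constant term of $y$. -}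

module Defs where

open import Level using (Level; _⊔_) renaming (suc to lsuc)
open import Algebra.Bundles using (CommutativeRing)
open import Data.Nat using (ℕ; zero; suc; _<_)
open import Relation.Nullary using (¬_)
open import Relation.Binary.PropositionalEquality using (_≡_)

record Field (c ℓ : Level) : Set (lsuc (c ⊔ ℓ)) where
  field
    commutativeRing : CommutativeRing c ℓ
  open CommutativeRing commutativeRing public
  field
    1≉0      : ¬ (1# ≈ 0#)
    inv      : (x : Carrier) → ¬ (x ≈ 0#) → Carrier
    inv-righ : ∀ x (p : ¬ (x ≈ 0#)) → (x * inv x p) ≈ 1#

module FieldTheory {c ℓ : Level} (K : Field c ℓ) where
  open Field K public using (Carrier; _≈_; 0#; 1#; _+_; _*_; inv)
  open Field K using ()

  ι : ℕ → Carrier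
  ι zero    = 0#
  ι (suc n) = 1# + ι n

  CharZero : Set ℓ
  CharZero = ∀ n → ι n ≈ 0# → n ≡ 0

  Series : Set c
  Series = ℕ → Carrier

  _≈ₛ_ : Series → Series → Set ℓ
  f ≈ₛ g = ∀ k → f k ≈ g k

  -- f and g agree on all coefficients of index < n, i.e. ω(f - g) ≥ n,
  -- i.e. d(f,g) ≤ 2^{-n}
  AgreeBelow : ℕ → Series → Series → Set ℓ
  AgreeBelow n f g = ∀ k → k < n → f k ≈ g k

  -- non-expansive: d(G f, G g) ≤ d(f, g) for all f g.  Since d takes
  -- values in {0} ∪ {2^{-n}}, this is: whenever ω(f-g) ≥ n, ω(Gf-Gg) ≥ n.
  NonExpansive : (Series → Series) → Set (c ⊔ ℓ)
  NonExpansive G = ∀ f g n → AgreeBelow n f g → AgreeBelow n (G f) (G g)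

  _+ₛ_ : Series → Series → Series
  (f +ₛ g) k = f k + g k

  constₛ : Carrier → Series
  constₛ a zero    = a
  constₛ a (suc k) = 0#

  D : Series → Series → Series
  D h s k = h (suc k) * s (suc k)

  I : (h : Series) → (∀ k → ¬ (h (suc k) ≈ 0#)) → Series → Series
  I h hnz s zero    = 0#
  I h hnz s (suc k) = s k * inv (h (suc k)) (hnz k)

{-# OPTIONS --safe #-}
module Submission where

open import Defs
open import Level using (Level; _⊔_)
open import Data.Nat using (ℕ; zero; suc; _<_; s≤s)
open import Data.Nat.Properties using (m≤n⇒m<n∨m≡n; n<1+n)
open import Data.Nat.GeneralisedArithmetic using (fold)
open import Data.Sum using (inj₁; inj₂)
open import Data.Product using (Σ; _×_; _,_)
open import Relation.Nullary using (¬_)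
import Relation.Binary.PropositionalEquality as ≡

-- The map F gains one coefficient of agreement per application
-- (y₀ fixes the constant term, and I_h shifts G(f), which is no worse than
-- f, up by one degree).  Hence the Picard iterates F^n(0) stabilise
-- coefficientwise to a fixed point, and any two fixed points agree below
-- every n.  Since h_k ≠ 0 for k ≥ 1, D_h(z) = G(z) with z(0) = y₀ is the
-- same as z = F(z), coefficient by coefficient.

module SeriesTheory {c ℓ : Level} (K : Field c ℓ) where
  open FieldTheory K
  open Field K using (refl; sym; trans; +-cong; *-cong; *-comm; *-assoc;
    +-identityˡ; +-identityʳ; *-identityˡ; *-identityʳ; inv-righ; setoid)
  open import Relation.Binary.Reasoning.Setoid setoid

  u*[g*u⁻¹]≈g : ∀ u g (u≉0 : ¬ (u ≈ 0#)) → u * (g * inv u u≉0) ≈ g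
  u*[g*u⁻¹]≈g u g u≉0 = begin
    u * (g * inv u u≉0)  ≈⟨ *-cong refl (*-comm g _) ⟩
    u * (inv u u≉0 * g)  ≈⟨ sym (*-assoc _ _ _) ⟩
    (u * inv u u≉0) * g  ≈⟨ *-cong (inv-righ u u≉0) refl ⟩
    1# * g               ≈⟨ *-identityˡ g ⟩
    g                    ∎

  u*v≈g⇒v≈g*u⁻¹ : ∀ u v g (u≉0 : ¬ (u ≈ 0#)) → u * v ≈ g → v ≈ g * inv u u≉0
  u*v≈g⇒v≈g*u⁻¹ u v g u≉0 uv≈g = begin
    v                    ≈⟨ sym (*-identityʳ v) ⟩
    v * 1#               ≈⟨ *-cong refl (sym (inv-righ u u≉0)) ⟩
    v * (u * inv u u≉0)  ≈⟨ sym (*-assoc _ _ _) ⟩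
    (v * u) * inv u u≉0  ≈⟨ *-cong (*-comm v u) refl ⟩
    (u * v) * inv u u≉0  ≈⟨ *-cong uv≈g refl ⟩
    g * inv u u≉0        ∎

  Contractive : (Series → Series) → Set (c ⊔ ℓ)
  Contractive F = ∀ f g n → AgreeBelow n f g → AgreeBelow (suc n) (F f) (F g)

  fixedPoints-agreeBelow : ∀ {F} → Contractive F → ∀ {z w} →
    z ≈ₛ F z → w ≈ₛ F w → ∀ n → AgreeBelow n z w
  fixedPoints-agreeBelow F-contr z≈Fz w≈Fw zero k ()
  fixedPoints-agreeBelow {F} F-contr {z} {w} z≈Fz w≈Fw (suc n) k k<1+n =
    trans (z≈Fz k) (trans Fz≈Fw (sym (w≈Fw k)))
    where
    Fz≈Fw : F z k ≈ F w k
    Fz≈Fw = F-contr z w n (fixedPoints-agreeBelow F-contr z≈Fz w≈Fw n) k k<1+n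

  module FixedPoint (F : Series → Series) (F-contr : Contractive F) where

    picard : ℕ → Series
    picard = fold (λ _ → 0#) F

    picard-step : ∀ n → AgreeBelow n (picard n) (picard (suc n))
    picard-step zero    k ()
    picard-step (suc n) = F-contr _ _ n (picard-step n)

    fixedPoint : Series
    fixedPoint k = picard (suc k) k

    picard-agreeBelow-fixedPoint : ∀ n → AgreeBelow n (picard n) fixedPoint
    picard-agreeBelow-fixedPoint (suc n) k (s≤s k≤n) with m≤n⇒m<n∨m≡n k≤n
    ... | inj₁ k<n    =
      trans (sym (picard-step n k k<n)) (picard-agreeBelow-fixedPoint n k k<n)
    ... | inj₂ ≡.refl = refl

    fixedPoint-isFixed : fixedPoint ≈ₛ F fixedPoint
    fixedPoint-isFixed k =
      F-contr _ _ k (picard-agreeBelow-fixedPoint k) k (n<1+n k)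

    fixedPoint-unique : ∀ z → z ≈ₛ F z → z ≈ₛ fixedPoint
    fixedPoint-unique z z≈Fz k = fixedPoints-agreeBelow
      F-contr z≈Fz fixedPoint-isFixed (suc k) k (n<1+n k)

  module HCalculus (h : Series) (hnz : ∀ k → ¬ (h (suc k) ≈ 0#)) where

    const+I-contractive : ∀ a {G} → NonExpansive G →
      Contractive (λ f → constₛ a +ₛ I h hnz (G f))
    const+I-contractive a G-ne f g n f≈g zero    _         = refl
    const+I-contractive a G-ne f g n f≈g (suc k) (s≤s k<n) =
      +-cong refl (*-cong (G-ne f g n f≈g k k<n) refl)

    const+I-antiderivative : ∀ {a s z} → z ≈ₛ (constₛ a +ₛ I h hnz s) →
      D h z ≈ₛ s × z zero ≈ a
    const+I-antiderivative {a} {s} {z} z≈a+Is =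
      D-z≈s , trans (z≈a+Is zero) (+-identityʳ a)
      where
      D-z≈s : D h z ≈ₛ s
      D-z≈s k = begin
        h (suc k) * z (suc k)                        ≈⟨ *-cong refl (z≈a+Is (suc k)) ⟩
        h (suc k) * (0# + s k * inv (h (suc k)) _)   ≈⟨ *-cong refl (+-identityˡ _) ⟩
        h (suc k) * (s k * inv (h (suc k)) (hnz k))  ≈⟨ u*[g*u⁻¹]≈g _ (s k) (hnz k) ⟩
        s k                                          ∎

    antiderivative≈const+I : ∀ {a s z} → D h z ≈ₛ s → z zero ≈ a →
      z ≈ₛ (constₛ a +ₛ I h hnz s)
    antiderivative≈const+I {a} _ z0≈a zero = trans z0≈a (sym (+-identityʳ a))
    antiderivative≈const+I {s = s} {z} D-z≈s _ (suc k) = trans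
      (u*v≈g⇒v≈g*u⁻¹ (h (suc k)) (z (suc k)) (s k) (hnz k) (D-z≈s k))
      (sym (+-identityˡ _))

mainTheorem2 : ∀ {c ℓ : Level} (K : Field c ℓ) →
    let open FieldTheory K in
    CharZero →
    (h : Series) → h zero ≈ 0# → (hnz : ∀ k → ¬ (h (suc k) ≈ 0#)) →
    (y₀ : Carrier) → (G : Series → Series) → NonExpansive G →
    Σ Series (λ y →
      -- y solves the IVP  D_h(y) = G(y), y(0) = y₀, uniquely
      ((D h y ≈ₛ G y × y zero ≈ y₀)
        × (∀ z → D h z ≈ₛ G z → z zero ≈ y₀ → z ≈ₛ y))
      -- y is the unique fixed point of F(f) = y₀ + (I_h ∘ G)(f)
      × ((y ≈ₛ (constₛ y₀ +ₛ I h hnz (G y)))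
        × (∀ z → z ≈ₛ (constₛ y₀ +ₛ I h hnz (G z)) → z ≈ₛ y)))
mainTheorem2 K _ h _ hnz y₀ G G-ne =
  fixedPoint ,
  ( (const+I-antiderivative fixedPoint-isFixed
    , λ z D-z≈Gz z0≈y₀ → fixedPoint-unique z (antiderivative≈const+I D-z≈Gz z0≈y₀))
  , (fixedPoint-isFixed , fixedPoint-unique))
  where
  open SeriesTheory K
  open HCalculus h hnz
  open FixedPoint _ (const+I-contractive y₀ G-ne)
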